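{- Let $(p,p')$ be positive integers with $|p-p'|=1$ and $\alpha=\alpha_{(p,p')}$. Let $X$ be a palindrome occurring in a Sturmian word, with center $c$, and write $X=UcU^R$. Then the center of the palindrome $b\,\alpha(X)=b\,\alpha(U)\,\alpha(c)\,\alpha(U^R)$ is the center of the palindrome $b\,\alpha(c)$, where $b\,\alpha(c)$ is the factor of $b\alpha(X)$ consisting of $\alpha(c)$ preceded by the letter $b$ immediately before it (the last letter of $b\alpha(U)$).
   Context: Words are over the alphabet $\{a,b\}$. A Sturmian word is a right-infinite aperiodic word over $\{a,b\}$ of minimal factor complexity. For positive integers $p,p'$ with $|p-p'|=1$, $\alpha_{(p,p')}$ is the morphism $a\mapsto a^pb$, $b\mapsto a^{p'}b$. A palindrome is a word equal to its reverse; $U^R$ denotes the reverse of $U$. The center of a palindrome $P$ is its middle letter if $|P|$ is odd, and its two middle letters (necessarily $aa$) if $|P|$ is even; centers are themselves palindromes. -}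

module Defs where

open import Data.Nat using (ℕ; zero; suc; _+_; _∸_; _<_; _≤_)
open import Data.Nat.DivMod using (_/_; _%_)
open import Data.List using (List; []; _∷_; _++_; length; reverse; take; drop; replicate; concatMap)
open import Data.List.Relation.Unary.Unique.Propositional using (Unique)
open import Data.List.Membership.Propositional using (_∈_)
open import Data.Product using (Σ; ∃; ∃-syntax; _×_; _,_)
open import Relation.Binary.PropositionalEquality using (_≡_)
open import Relation.Nullary using (¬_)

data Letter : Set where
  a b : Letter

Word : Set
Word = List Letter

InfWord : Set
InfWord = ℕ → Letter

pref : InfWord → ℕ → Word
pref x zero    = []
pref x (suc n) = x 0 ∷ pref (λ j → x (suc j)) n

Factor : Word → InfWord → Set
Factor w x = ∃[ i ] pref (λ j → x (i + j)) (length w) ≡ w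

EventuallyPeriodic : InfWord → Set
EventuallyPeriodic x = ∃[ q ] ∃[ N ] (0 < q × (∀ i → N ≤ i → x (i + q) ≡ x i))

Aperiodic : InfWord → Set
Aperiodic x = ¬ EventuallyPeriodic x

ComplexityIs : InfWord → ℕ → ℕ → Set
ComplexityIs x n k =
  Σ (List Word) λ L →
    length L ≡ k × Unique L
    × (∀ w → w ∈ L → length w ≡ n × Factor w x)
    × (∀ w → length w ≡ n → Factor w x → w ∈ L)

Sturmian : InfWord → Set
Sturmian x = Aperiodic x × (∀ n → ComplexityIs x n (suc n))

Palindrome : Word → Set
Palindrome w = reverse w ≡ w

-- center of a word: middle letter if odd length, two middle letters if even
-- (for |w| = 2k+1: drop k, take 1; for |w| = 2k ≥ 2: drop (k-1), take 2)
center : Word → Word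
center w = take (2 ∸ (length w % 2)) (drop ((length w ∸ 1) / 2) w)

αimg : ℕ → ℕ → Letter → Word
αimg p p' a = replicate p a ++ (b ∷ [])
αimg p p' b = replicate p' a ++ (b ∷ [])

α : ℕ → ℕ → Word → Word
α p p' = concatMap (αimg p p')

-- In b α(U) α(c) α(U^R) the letter b can be moved across α(U): every image
-- α(x) ends with b, so b α(U) = β(U) b for the conjugate morphism β, x ↦ b a^k.
-- Hence b α(X) = β(U) · b α(c) · α(U^R), and |β(U)| = |α(U)| = |α(U^R)|.
-- Stripping equally long words from both ends does not move the center of a
-- nonempty word, so the center of b α(X) is that of b α(c).
-- This holds for all words U and c and all p, p'.
module Submission where

open import Defs
open import Data.Nat using (ℕ; zero; suc; _+_; _∸_; _≤_; z≤n; s≤s)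
open import Data.Nat.Properties using (+-comm; n≤1+n; suc-injective; module ≤-Reasoning)
open import Data.Nat.DivMod using (_/_; _%_; m/n≡1+[m∸n]/n; [m+n]%n≡m%n)
open import Data.List using (List; []; _∷_; _++_; [_]; length; reverse; take; drop; replicate; concatMap)
open import Data.List.Properties using (++-assoc; ++-identityʳ; ++-conicalʳ; length-++; length-reverse; reverse-involutive; unfold-reverse; concatMap-++)
open import Data.Product using (∃-syntax; _×_)
open import Data.Sum using (_⊎_)
open import Data.Empty using (⊥-elim)
open import Function using (_∘_)
open import Relation.Binary.PropositionalEquality using (_≡_; _≢_; refl; sym; trans; cong; cong₂; module ≡-Reasoning)

private
  variable
    A B : Set

take-++ˡ : ∀ t (xs ys : List A) → t ≤ length xs → take t (xs ++ ys) ≡ take t xs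
take-++ˡ zero    xs       ys _         = refl
take-++ˡ (suc t) (x ∷ xs) ys (s≤s t≤) = cong (x ∷_) (take-++ˡ t xs ys t≤)

take-drop-++ˡ : ∀ j t (xs ys : List A) → j + t ≤ length xs →
                take t (drop j (xs ++ ys)) ≡ take t (drop j xs)
take-drop-++ˡ zero    t xs       ys j+t≤ = take-++ˡ t xs ys j+t≤
take-drop-++ˡ (suc j) t (x ∷ xs) ys (s≤s j+t≤) = take-drop-++ˡ j t xs ys j+t≤

length-∷ʳ : ∀ (xs : List A) y → length (xs ++ [ y ]) ≡ suc (length xs)
length-∷ʳ xs y = trans (length-++ xs) (+-comm (length xs) 1)

++-∷-≢[] : ∀ (xs : List A) y ys → xs ++ y ∷ ys ≢ []
++-∷-≢[] xs y ys eq with ++-conicalʳ xs (y ∷ ys) eq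
... | ()

offset width : ℕ → ℕ
offset n = (n ∸ 1) / 2
width  n = 2 ∸ n % 2

offset-2+ : ∀ n → offset (2 + suc n) ≡ suc (offset (suc n))
offset-2+ n = m/n≡1+[m∸n]/n {suc (suc n)} {2} (s≤s (s≤s z≤n))

width-2+ : ∀ n → width (2 + n) ≡ width n
width-2+ n = trans (cong (λ k → 2 ∸ k % 2) (+-comm 2 n)) (cong (2 ∸_) ([m+n]%n≡m%n n 2))

center-fits : ∀ n → offset (suc n) + width (suc n) ≤ suc n
center-fits zero          = s≤s z≤n
center-fits (suc zero)    = s≤s (s≤s z≤n)
center-fits (suc (suc n)) = begin
  offset (3 + n) + width (3 + n)        ≡⟨ cong₂ _+_ (offset-2+ n) (width-2+ (suc n)) ⟩
  suc (offset (suc n) + width (suc n))  ≤⟨ s≤s (center-fits n) ⟩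
  2 + n                                 ≤⟨ n≤1+n (2 + n) ⟩
  3 + n                                 ∎
  where open ≤-Reasoning

center-∷-∷ʳ : ∀ x y (v : Word) → v ≢ [] → center (x ∷ v ++ [ y ]) ≡ center v
center-∷-∷ʳ x y []         v≢[] = ⊥-elim (v≢[] refl)
center-∷-∷ʳ x y v@(_ ∷ w) _    = begin
  center (x ∷ v ++ [ y ])
    ≡⟨ cong (λ n → take (width n) (drop (offset n) (x ∷ v ++ [ y ]))) (cong suc (length-∷ʳ v y)) ⟩
  take (width (2 + length v)) (drop (offset (2 + length v)) (x ∷ v ++ [ y ]))
    ≡⟨ cong₂ (λ t j → take t (drop j (x ∷ v ++ [ y ]))) (width-2+ (length v)) (offset-2+ (length w)) ⟩
  take (width (length v)) (drop (offset (length v)) (v ++ [ y ]))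
    ≡⟨ take-drop-++ˡ (offset (length v)) (width (length v)) v [ y ] (center-fits (length w)) ⟩
  center v
    ∎
  where open ≡-Reasoning

center-++-++-reverse : ∀ (u : Word) z v w → length u ≡ length w →
                       center (u ++ z ∷ v ++ reverse w) ≡ center (z ∷ v)
center-++-++-reverse []      z v []      _ = cong center (++-identityʳ (z ∷ v))
center-++-++-reverse (x ∷ u) z v (y ∷ w) |u|≡|w| = begin
  center (x ∷ u ++ z ∷ v ++ reverse (y ∷ w))
    ≡⟨ cong (λ r → center (x ∷ u ++ z ∷ v ++ r)) (unfold-reverse y w) ⟩
  center (x ∷ u ++ z ∷ v ++ reverse w ++ [ y ])
    ≡⟨ cong (λ r → center (x ∷ u ++ z ∷ r)) (sym (++-assoc v (reverse w) [ y ])) ⟩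
  center (x ∷ u ++ (z ∷ v ++ reverse w) ++ [ y ])
    ≡⟨ cong (λ r → center (x ∷ r)) (sym (++-assoc u (z ∷ v ++ reverse w) [ y ])) ⟩
  center (x ∷ (u ++ z ∷ v ++ reverse w) ++ [ y ])
    ≡⟨ center-∷-∷ʳ x y _ (++-∷-≢[] u z (v ++ reverse w)) ⟩
  center (u ++ z ∷ v ++ reverse w)
    ≡⟨ center-++-++-reverse u z v w (suc-injective |u|≡|w|) ⟩
  center (z ∷ v)
    ∎
  where open ≡-Reasoning

center-++-++ : ∀ (u : Word) z v w → length u ≡ length w →
               center (u ++ z ∷ v ++ w) ≡ center (z ∷ v)
center-++-++ u z v w |u|≡|w| = begin
  center (u ++ z ∷ v ++ w)
    ≡⟨ cong (λ r → center (u ++ z ∷ v ++ r)) (sym (reverse-involutive w)) ⟩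
  center (u ++ z ∷ v ++ reverse (reverse w))
    ≡⟨ center-++-++-reverse u z v (reverse w) (trans |u|≡|w| (sym (length-reverse w))) ⟩
  center (z ∷ v)
    ∎
  where open ≡-Reasoning

concatMap-conjugate : ∀ (f g : A → List B) z → (∀ x → z ∷ f x ≡ g x ++ [ z ]) →
                      ∀ xs → z ∷ concatMap f xs ≡ concatMap g xs ++ [ z ]
concatMap-conjugate f g z conj []       = refl
concatMap-conjugate f g z conj (x ∷ xs) = begin
  z ∷ f x ++ concatMap f xs              ≡⟨ cong (_++ concatMap f xs) (conj x) ⟩
  (g x ++ [ z ]) ++ concatMap f xs       ≡⟨ ++-assoc (g x) [ z ] (concatMap f xs) ⟩
  g x ++ z ∷ concatMap f xs              ≡⟨ cong (g x ++_) (concatMap-conjugate f g z conj xs) ⟩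
  g x ++ concatMap g xs ++ [ z ]         ≡⟨ ++-assoc (g x) (concatMap g xs) [ z ] ⟨
  (g x ++ concatMap g xs) ++ [ z ]       ∎
  where open ≡-Reasoning

length-concatMap-reverse : ∀ (f : A → List B) xs →
                           length (concatMap f (reverse xs)) ≡ length (concatMap f xs)
length-concatMap-reverse f []       = refl
length-concatMap-reverse f (x ∷ xs) = begin
  length (concatMap f (reverse (x ∷ xs)))            ≡⟨ cong (length ∘ concatMap f) (unfold-reverse x xs) ⟩
  length (concatMap f (reverse xs ++ [ x ]))         ≡⟨ cong length (concatMap-++ f (reverse xs) [ x ]) ⟩
  length (concatMap f (reverse xs) ++ f x ++ [])     ≡⟨ length-++ (concatMap f (reverse xs)) ⟩
  length (concatMap f (reverse xs)) + length (f x ++ [])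
    ≡⟨ cong₂ _+_ (length-concatMap-reverse f xs) (cong length (++-identityʳ (f x))) ⟩
  length (concatMap f xs) + length (f x)             ≡⟨ +-comm (length (concatMap f xs)) (length (f x)) ⟩
  length (f x) + length (concatMap f xs)             ≡⟨ length-++ (f x) ⟨
  length (concatMap f (x ∷ xs))                      ∎
  where open ≡-Reasoning

length-∷≡∷ʳ : ∀ {z : A} {xs ys} → z ∷ xs ≡ ys ++ [ z ] → length ys ≡ length xs
length-∷≡∷ʳ {z = z} {ys = ys} eq = suc-injective (trans (sym (length-∷ʳ ys z)) (sym (cong length eq)))

αimg-conjugate : ℕ → ℕ → Letter → Word
αimg-conjugate p p' a = b ∷ replicate p a
αimg-conjugate p p' b = b ∷ replicate p' a

b∷αimg : ∀ p p' x → b ∷ αimg p p' x ≡ αimg-conjugate p p' x ++ [ b ]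
b∷αimg p p' a = refl
b∷αimg p p' b = refl

corollary1 : (p p' : ℕ) → 1 ≤ p → 1 ≤ p' → (p' ≡ suc p ⊎ p ≡ suc p')
    → (X : Word) → Palindrome X
    → (∃[ s ] (Sturmian s × Factor X s))
    → (U c : Word) → c ≡ center X → X ≡ U ++ c ++ reverse U
    → center (b ∷ α p p' X) ≡ center (b ∷ α p p' c)
corollary1 p p' _ _ _ X _ _ U c _ refl = begin
  center (b ∷ α p p' (U ++ c ++ reverse U))
    ≡⟨ cong (λ w → center (b ∷ w)) α-split ⟩
  center (b ∷ α p p' U ++ α p p' c ++ α p p' (reverse U))
    ≡⟨ cong (λ w → center (w ++ α p p' c ++ α p p' (reverse U))) b∷αU ⟩
  center ((βU ++ [ b ]) ++ α p p' c ++ α p p' (reverse U))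
    ≡⟨ cong center (++-assoc βU [ b ] _) ⟩
  center (βU ++ b ∷ α p p' c ++ α p p' (reverse U))
    ≡⟨ center-++-++ βU b (α p p' c) (α p p' (reverse U)) |βU|≡|αU^R| ⟩
  center (b ∷ α p p' c)
    ∎
  where
  open ≡-Reasoning
  βU : Word
  βU = concatMap (αimg-conjugate p p') U
  b∷αU : b ∷ α p p' U ≡ βU ++ [ b ]
  b∷αU = concatMap-conjugate (αimg p p') (αimg-conjugate p p') b (b∷αimg p p') U
  |βU|≡|αU^R| : length βU ≡ length (α p p' (reverse U))
  |βU|≡|αU^R| = trans (length-∷≡∷ʳ b∷αU) (sym (length-concatMap-reverse (αimg p p') U))
  α-split : α p p' (U ++ c ++ reverse U) ≡ α p p' U ++ α p p' c ++ α p p' (reverse U)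
  α-split = trans (concatMap-++ (αimg p p') U _) (cong (α p p' U ++_) (concatMap-++ (αimg p p') c _))
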